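{- Let $b$ be a positive integer, let $T$ be a $b$-good tree, and let $\mathbf v=(v_1,\dots,v_t)$ be an $(\varnothing,b)$-admissible sequence for $T$. Then $$\gamma'_{MB}(T,b)=\frac{v(T)-v(T_{\downarrow\mathbf v})}{b+1}+\gamma'_{MB}(T_{\downarrow\mathbf v},b).$$
   Context: $N(v)$ is the neighbourhood of $v$ in $T$; for a forest $F$, $L(F)$ is its set of leaves (vertices of degree $1$); $v(H)$ is the number of vertices of $H$. For a sequence $\mathbf v=(v_1,\dots,v_t)$ of distinct vertices of $T$ define $F_0:=T$, $F_i:=F_{i-1}-(\{v_i\}\cup(N(v_i)\cap L(F_{i-1})))$ for $i=1,\dots,t$, and $T_{\downarrow\mathbf v}:=F_t$. The sequence is $(\varnothing,b)$-admissible if $|N(v_i)\cap L(T_{\downarrow(v_1,\dots,v_{i-1})})|=b$ for all $i$. A sequence $(v_1,\dots,v_t,u)$ is problematic if $(v_1,\dots,v_t)$ is $(\varnothing,b)$-admissible and $|N(u)\cap L(T_{\downarrow(v_1,\dots,v_t)})|\geq b+1$; $T$ is $b$-good if no problematic sequence exists. The $b$-biased Maker-Breaker domination game on a finite graph $G$: Dominator and Staller alternately claim previously unclaimed vertices of $G$; in each of her turns Dominator claims up to $b$ vertices, in each of his turns Staller claims one vertex; a round consists of one turn of each player. Dominator wins if her claimed vertices contain a dominating set of $G$; otherwise Staller wins. $\gamma'_{MB}(G,b)$ is the smallest number of rounds within which Dominator can guarantee to win when Staller moves first (optimal play), and $\infty$ if Staller has a winning strategy. -}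

module Defs where

open import Data.Nat using (ℕ; zero; suc; _≤_; _<_; _≡ᵇ_; _+_; _∸_; _/_)
open import Data.Bool using (Bool; true; false; _∧_)
open import Data.Fin using (Fin)
open import Data.Fin.Subset using (Subset; _∈_; _∉_; _⊆_; _∩_; _∪_; _─_; ⁅_⁆; ∣_∣; ⊤; ⊥)
open import Data.Vec using (tabulate; lookup)
open import Data.List using (List; []; _∷_; _++_; [_])
open import Data.List.Relation.Unary.Unique.Propositional using (Unique)
open import Data.Maybe using (Maybe; just; nothing)
open import Data.Product using (Σ; ∃; _×_; _,_)
open import Data.Sum using (_⊎_)
open import Relation.Binary.PropositionalEquality using (_≡_; _≢_)
open import Relation.Nullary using (¬_)

record Graph (n : ℕ) : Set where
  field
    adj    : Fin n → Fin n → Bool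
    sym    : ∀ u v → adj u v ≡ adj v u
    irrefl : ∀ v → adj v v ≡ false

module _ {n : ℕ} (G : Graph n) where
  open Graph G

  Adjacent : Fin n → Fin n → Set
  Adjacent u v = adj u v ≡ true

  data Walk : Fin n → Fin n → Set where
    here : ∀ {v} → Walk v v
    step : ∀ {u w v} → Adjacent u w → Walk w v → Walk u v

  Connected : Set
  Connected = ∀ u v → Walk u v

  Chain : List (Fin n) → Set
  Chain []           = Data.Unit.⊤ where import Data.Unit
  Chain (x ∷ [])     = Data.Unit.⊤ where import Data.Unit
  Chain (x ∷ y ∷ xs) = Adjacent x y × Chain (y ∷ xs)

  IsCycle : List (Fin n) → Set
  IsCycle []               = Data.Empty.⊥ where import Data.Empty
  IsCycle (x ∷ [])         = Data.Empty.⊥ where import Data.Empty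
  IsCycle (x ∷ y ∷ [])     = Data.Empty.⊥ where import Data.Empty
  IsCycle (x ∷ y ∷ z ∷ xs) =
    Unique (x ∷ y ∷ z ∷ xs) × Chain (x ∷ y ∷ z ∷ xs) × Σ (Fin n) λ l →
      Data.List.last (z ∷ xs) ≡ just l × Adjacent l x
    where import Data.List

  Acyclic : Set
  Acyclic = ∀ xs → ¬ IsCycle xs

  IsTree : Set
  IsTree = 1 ≤ n × Connected × Acyclic

  -- Forests as induced subgraphs G[S], S ⊆ V(G)

  N : Fin n → Subset n
  N v = tabulate (adj v)

  leaves : Subset n → Subset n
  leaves S = tabulate λ u → lookup S u ∧ (∣ N u ∩ S ∣ ≡ᵇ 1)

  stepDown : Subset n → Fin n → Subset n
  stepDown S v = S ─ (⁅ v ⁆ ∪ (N v ∩ leaves S))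

  down : Subset n → List (Fin n) → Subset n
  down S []       = S
  down S (v ∷ vs) = down (stepDown S v) vs

  T↓ : List (Fin n) → Subset n
  T↓ vs = down ⊤ vs

  AdmissibleFrom : ℕ → Subset n → List (Fin n) → Set
  AdmissibleFrom b S []       = Data.Unit.⊤ where import Data.Unit
  AdmissibleFrom b S (v ∷ vs) =
    ∣ N v ∩ leaves S ∣ ≡ b × AdmissibleFrom b (stepDown S v) vs

  Admissible : ℕ → List (Fin n) → Set
  Admissible b vs = Unique vs × AdmissibleFrom b ⊤ vs

  Problematic : ℕ → List (Fin n) → Fin n → Set
  Problematic b vs u =
    Unique (vs ++ [ u ]) × AdmissibleFrom b ⊤ vs × suc b ≤ ∣ N u ∩ leaves (T↓ vs) ∣

  Good : ℕ → Set
  Good b = ∀ vs u → ¬ Problematic b vs u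

  Dominates : Subset n → Subset n → Set
  Dominates S D = ∀ v → v ∈ S → v ∈ D ⊎ Σ (Fin n) λ u → u ∈ D × Adjacent u v

  -- position (D = Dominator's vertices, St = Staller's vertices)
  Unclaimed : Subset n → Subset n → Subset n → Fin n → Set
  Unclaimed S D St x = x ∈ S × x ∉ D × x ∉ St

  -- DomWins S b k D St : from this position, with Staller to move,
  -- Dominator can guarantee that her vertices dominate G[S] within k rounds
  DomWins : Subset n → ℕ → ℕ → Subset n → Subset n → Set
  DomWins S b zero    D St = Dominates S D
  DomWins S b (suc k) D St =
    Dominates S D ⊎
    ( (Σ (Fin n) λ x → Unclaimed S D St x)
    × (∀ x → Unclaimed S D St x →
         Σ (Subset n) λ A →
           (∀ y → y ∈ A → Unclaimed S D (St ∪ ⁅ x ⁆) y)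
         × ∣ A ∣ ≤ b
         × DomWins S b k (D ∪ A) (St ∪ ⁅ x ⁆)) )

  -- γ'_MB(G[S], b) = g   (nothing encodes ∞)
  IsGammaMB : Subset n → ℕ → Maybe ℕ → Set
  IsGammaMB S b (just m) =
    DomWins S b m ⊥ ⊥ × (∀ k → k < m → ¬ DomWins S b k ⊥ ⊥)
  IsGammaMB S b nothing = ∀ k → ¬ DomWins S b k ⊥ ⊥

_+∞_ : ℕ → Maybe ℕ → Maybe ℕ
d +∞ just m  = just (d + m)
d +∞ nothing = nothing

{-# OPTIONS --safe #-}
-- Removing a pendant star (a centre v of the current forest together with its exactly b
-- leaf neighbours) costs Dominator exactly one round and deletes b + 1 vertices.
-- Lower bound: Staller opens on v.  Each leaf can now be dominated only by itself, so
-- Dominator must take all b leaves at once, or Staller blocks one; afterwards the game is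
-- the game on the remaining forest.  Upper bound: Dominator follows her strategy for the
-- remaining forest; when Staller first enters the star she takes its b other vertices,
-- which dominate it, and if the remaining forest is dominated first she takes v.
-- Along an admissible sequence every centre is still present when its turn comes: a
-- removed vertex is an earlier centre (excluded by distinctness) or a leaf whose only
-- neighbour has gone, which can have no pendants.

module Submission where

open import Defs
open import Data.Nat using (ℕ; zero; suc; _+_; _*_; _∸_; _≤_; _<_; _/_; _≡ᵇ_; z≤n; s≤s)
open import Data.Nat.Properties
  using (+-suc; +-assoc; +-comm; +-identityʳ; ≤-trans; ≤-reflexive; ≤-pred; ≤⇒≯; <-irrefl; n≮0;
         ≡ᵇ⇒≡; +-monoʳ-<; ∸-monoˡ-<; m+[n∸m]≡n; m+n∸m≡n)
open import Data.Nat.DivMod using (m*n/n≡m)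
open import Data.Bool using (Bool; true; _∧_)
open import Data.Bool.Properties using (∧-conicalˡ; ∧-conicalʳ; T-≡)
open import Data.Fin using (Fin; zero; _≟_)
open import Data.Fin.Properties using (any?)
open import Data.Fin.Subset
open import Data.Fin.Subset.Properties
open import Data.Vec using (_∷_; []; here; there; lookup; tabulate)
open import Data.Vec.Properties using ([]=⇒lookup; lookup⇒[]=; lookup∘tabulate)
open import Data.List using (List; []; _∷_; length)
open import Data.List.Membership.Propositional using () renaming (_∈_ to _∈ˡ_)
open import Data.List.Relation.Unary.Any using () renaming (here to hereˡ; there to thereˡ)
import Data.List.Relation.Unary.All as All
open import Data.List.Relation.Unary.AllPairs using (_∷_)
open import Data.List.Relation.Unary.Unique.Propositional using (Unique)
open import Data.Maybe using (Maybe; just; nothing)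
open import Data.Product using (Σ; _×_; _,_; proj₁; proj₂; map; map₁)
open import Data.Sum using (_⊎_; inj₁; inj₂; [_,_])
open import Data.Empty using (⊥-elim)
open import Function using (id; flip; _∘_; _⇔_; mk⇔; Equivalence)
open import Relation.Nullary using (¬_; yes; no; contradiction)
open import Relation.Nullary.Decidable using (_×-dec_; ¬?)
open import Relation.Unary using (_≐_)
open import Relation.Binary.PropositionalEquality hiding ([_])
open ≡-Reasoning

private variable
  n : ℕ
  x y : Fin n
  p q r : Subset n

∈tabulate⁻ : ∀ (f : Fin n → Bool) → x ∈ tabulate f → f x ≡ true
∈tabulate⁻ {x = x} f x∈ = trans (sym (lookup∘tabulate f x)) ([]=⇒lookup x∈)

∈tabulate⁺ : ∀ (f : Fin n → Bool) → f x ≡ true → x ∈ tabulate f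
∈tabulate⁺ {x = x} f fx = lookup⇒[]= x (tabulate f) (trans (lookup∘tabulate f x) fx)

x∈p─q⁻ : ∀ (p q : Subset n) → x ∈ p ─ q → x ∈ p × x ∉ q
x∈p─q⁻ (_ ∷ p) (outside ∷ q) here       = here , λ ()
x∈p─q⁻ (_ ∷ p) (_ ∷ q)       (there x∈) = map there (_∘ drop-there) (x∈p─q⁻ p q x∈)

x∉p∪q : x ∉ p → x ∉ q → x ∉ p ∪ q
x∉p∪q {p = p} {q = q} x∉p x∉q = [ x∉p , x∉q ] ∘ x∈p∪q⁻ p q

x∉p∪q⁻ : ∀ p → x ∉ p ∪ q → x ∉ p × x ∉ q
x∉p∪q⁻ {q = q} p x∉ = x∉ ∘ p⊆p∪q q , x∉ ∘ q⊆p∪q p q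

∪-lub : p ⊆ r → q ⊆ r → p ∪ q ⊆ r
∪-lub {p = p} {q = q} p⊆r q⊆r = [ p⊆r , q⊆r ] ∘ x∈p∪q⁻ p q

0<∣p∣⇒Nonempty : 0 < ∣ p ∣ → Nonempty p
0<∣p∣⇒Nonempty {n} {p} 0<∣p∣ with nonempty? p
... | yes nonempty = nonempty
... | no  empty    = contradiction (subst (0 <_) ∣p∣≡0 0<∣p∣) n≮0
  where
  ∣p∣≡0 : ∣ p ∣ ≡ 0
  ∣p∣≡0 = trans (cong ∣_∣ (Empty-unique empty)) (∣⊥∣≡0 n)

x∈p⇒⁅x⁆⊆p : x ∈ p → ⁅ x ⁆ ⊆ p
x∈p⇒⁅x⁆⊆p {x = x} {p} x∈p y∈⁅x⁆ =
  subst (_∈ p) (sym (x∈⁅y⁆⇒x≡y x y∈⁅x⁆)) x∈p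

∣p∣≡1⇒x≡y : ∣ p ∣ ≡ 1 → x ∈ p → y ∈ p → x ≡ y
∣p∣≡1⇒x≡y {p = p} {x} {y} ∣p∣≡1 x∈p y∈p with x ≟ y
... | yes x≡y = x≡y
... | no  x≢y =
  contradiction (p⊂q⇒∣p∣<∣q∣ ⁅x⁆⊂p) (<-irrefl (trans (∣⁅x⁆∣≡1 x) (sym ∣p∣≡1)))
  where
  ⁅x⁆⊂p : ⁅ x ⁆ ⊂ p
  ⁅x⁆⊂p = x∈p⇒⁅x⁆⊆p x∈p , y , y∈p , x≢y ∘ sym ∘ x∈⁅y⁆⇒x≡y x

p⊆q∧∣q∣≤∣p∣⇒q⊆p : p ⊆ q → ∣ q ∣ ≤ ∣ p ∣ → q ⊆ p
p⊆q∧∣q∣≤∣p∣⇒q⊆p {p = p} p⊆q ∣q∣≤∣p∣ {x} x∈q with x ∈? p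
... | yes x∈p = x∈p
... | no  x∉p =
  contradiction (p⊂q⇒∣p∣<∣q∣ (p⊆q , x , x∈q , x∉p)) (≤⇒≯ ∣q∣≤∣p∣)

∣p─q∣+∣q∣≡∣p∣ : ∀ (p q : Subset n) → q ⊆ p → ∣ p ─ q ∣ + ∣ q ∣ ≡ ∣ p ∣
∣p─q∣+∣q∣≡∣p∣ []            []            _   = refl
∣p─q∣+∣q∣≡∣p∣ (inside ∷ p)  (inside ∷ q)  q⊆p =
  trans (+-suc _ _) (cong suc (∣p─q∣+∣q∣≡∣p∣ p q (drop-∷-⊆ q⊆p)))
∣p─q∣+∣q∣≡∣p∣ (outside ∷ p) (inside ∷ q)  q⊆p = contradiction (q⊆p here) λ ()
∣p─q∣+∣q∣≡∣p∣ (inside ∷ p)  (outside ∷ q) q⊆p =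
  cong suc (∣p─q∣+∣q∣≡∣p∣ p q (drop-∷-⊆ q⊆p))
∣p─q∣+∣q∣≡∣p∣ (outside ∷ p) (outside ∷ q) q⊆p = ∣p─q∣+∣q∣≡∣p∣ p q (drop-∷-⊆ q⊆p)

∣p∪q∣≡∣p∣+∣q∣ : ∀ (p q : Subset n) → Empty (p ∩ q) → ∣ p ∪ q ∣ ≡ ∣ p ∣ + ∣ q ∣
∣p∪q∣≡∣p∣+∣q∣ []            []            _ = refl
∣p∪q∣≡∣p∣+∣q∣ (inside ∷ p)  (inside ∷ q)  e = contradiction (zero , here) e
∣p∪q∣≡∣p∣+∣q∣ (inside ∷ p)  (outside ∷ q) e =
  cong suc (∣p∪q∣≡∣p∣+∣q∣ p q (drop-∷-Empty e))
∣p∪q∣≡∣p∣+∣q∣ (outside ∷ p) (inside ∷ q)  e =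
  trans (cong suc (∣p∪q∣≡∣p∣+∣q∣ p q (drop-∷-Empty e))) (sym (+-suc _ _))
∣p∪q∣≡∣p∣+∣q∣ (outside ∷ p) (outside ∷ q) e = ∣p∪q∣≡∣p∣+∣q∣ p q (drop-∷-Empty e)

module _ {n : ℕ} (T : Graph n) where
  open Graph T using (adj) renaming (sym to adj-sym; irrefl to adj-irrefl)

  private variable
    u v w z ℓ : Fin n
    S S′ S₁ S₂ D D′ St St′ A : Subset n

  Adjacent-sym : Adjacent T u w → Adjacent T w u
  Adjacent-sym {u} {w} u~w = trans (adj-sym w u) u~w

  Adjacent-irrefl : ¬ Adjacent T v v
  Adjacent-irrefl {v} v~v with trans (sym (adj-irrefl v)) v~v
  ... | ()

  ∈N⁻ : x ∈ N T v → Adjacent T v x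
  ∈N⁻ {v = v} = ∈tabulate⁻ (adj v)

  ∈N⁺ : Adjacent T v x → x ∈ N T v
  ∈N⁺ {v = v} = ∈tabulate⁺ (adj v)

  ∈leaves⁻ : x ∈ leaves T S → x ∈ S × ∣ N T x ∩ S ∣ ≡ 1
  ∈leaves⁻ {x} {S} x∈ =
    lookup⇒[]= x S (∧-conicalˡ _ _ leaf) ,
    ≡ᵇ⇒≡ _ 1 (Equivalence.from T-≡ (∧-conicalʳ _ _ leaf))
    where
    leaf : lookup S x ∧ (∣ N T x ∩ S ∣ ≡ᵇ 1) ≡ true
    leaf = ∈tabulate⁻ (λ u → lookup S u ∧ (∣ N T u ∩ S ∣ ≡ᵇ 1)) x∈

  Dominates-mono : D ⊆ D′ → Dominates T S D → Dominates T S D′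
  Dominates-mono D⊆D′ dom x x∈S with dom x x∈S
  ... | inj₁ x∈D              = inj₁ (D⊆D′ x∈D)
  ... | inj₂ (u , u∈D , u~x) = inj₂ (u , D⊆D′ u∈D , u~x)

  Dominates-cover : (∀ {x} → x ∈ S → x ∈ S₁ ⊎ x ∈ S₂) →
                    Dominates T S₁ D → Dominates T S₂ D → Dominates T S D
  Dominates-cover cover dom₁ dom₂ x x∈S = [ dom₁ x , dom₂ x ] (cover x∈S)

  ¬Dominates-⊥ : v ∈ S → ¬ Dominates T S ⊥
  ¬Dominates-⊥ {v} v∈S dom = [ ∉⊥ , ∉⊥ ∘ proj₁ ∘ proj₂ ] (dom v v∈S)

  Unclaimed-staller⁺ : Unclaimed T S D St z → z ≢ x → Unclaimed T S D (St ∪ ⁅ x ⁆) z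
  Unclaimed-staller⁺ (z∈S , z∉D , z∉St) z≢x = z∈S , z∉D , x∉p∪q z∉St (x≢y⇒x∉⁅y⁆ z≢x)

  Unclaimed-staller⁻ : Unclaimed T S D (St ∪ ⁅ x ⁆) z → Unclaimed T S D St z × z ≢ x
  Unclaimed-staller⁻ {St = St} (z∈S , z∉D , z∉St∪x) =
    (z∈S , z∉D , proj₁ (x∉p∪q⁻ St z∉St∪x)) , x∉⁅y⁆⇒x≢y (proj₂ (x∉p∪q⁻ St z∉St∪x))

  Unclaimed-dominator⁺ : Unclaimed T S D St z → z ∉ A → Unclaimed T S (D ∪ A) St z
  Unclaimed-dominator⁺ (z∈S , z∉D , z∉St) z∉A = z∈S , x∉p∪q z∉D z∉A , z∉St

  Unclaimed-dominator⁻ : Unclaimed T S (D ∪ A) St z → Unclaimed T S D St z × z ∉ A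
  Unclaimed-dominator⁻ {D = D} (z∈S , z∉D∪A , z∉St) =
    (z∈S , proj₁ (x∉p∪q⁻ D z∉D∪A) , z∉St) , proj₂ (x∉p∪q⁻ D z∉D∪A)

  ≐-staller : Unclaimed T S D St ≐ Unclaimed T S′ D′ St′ →
              Unclaimed T S D (St ∪ ⁅ x ⁆) ≐ Unclaimed T S′ D′ (St′ ∪ ⁅ x ⁆)
  ≐-staller (to , from) = claim to , claim from
    where
    claim : (∀ {z} → Unclaimed T S₁ D St z → Unclaimed T S₂ D′ St′ z) →
            ∀ {z} → Unclaimed T S₁ D (St ∪ ⁅ x ⁆) z → Unclaimed T S₂ D′ (St′ ∪ ⁅ x ⁆) z
    claim f free =
      let (free′ , z≢x) = Unclaimed-staller⁻ free in Unclaimed-staller⁺ (f free′) z≢x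

  ≐-dominator : Unclaimed T S D St ≐ Unclaimed T S′ D′ St′ →
                Unclaimed T S (D ∪ A) St ≐ Unclaimed T S′ (D′ ∪ A) St′
  ≐-dominator (to , from) = claim to , claim from
    where
    claim : (∀ {z} → Unclaimed T S₁ D St z → Unclaimed T S₂ D′ St′ z) →
            ∀ {z} → Unclaimed T S₁ (D ∪ A) St z → Unclaimed T S₂ (D′ ∪ A) St′ z
    claim f free =
      let (free′ , z∉A) = Unclaimed-dominator⁻ free in Unclaimed-dominator⁺ (f free′) z∉A

  record Simulation (S S′ : Subset n) : Set₁ where
    field
      Related   : Subset n → Subset n → Set
      related-∪ : ∀ {D X} A → Related D X → Related (D ∪ A) (X ∪ A)
      dominates : ∀ {D X} → Related D X → Dominates T S′ X → Dominates T S D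

  Blocked : Subset n → Subset n → Subset n → Fin n → Set
  Blocked S D St ℓ =
    ℓ ∈ S × ℓ ∉ D × (∀ w → Adjacent T w ℓ → w ∉ D × ¬ Unclaimed T S D St w)

  Blocked⇒¬Dominates : Blocked S D St ℓ → ¬ Dominates T S D
  Blocked⇒¬Dominates {ℓ = ℓ} (ℓ∈S , ℓ∉D , nbrs) dom with dom ℓ ℓ∈S
  ... | inj₁ ℓ∈D              = ℓ∉D ℓ∈D
  ... | inj₂ (w , w∈D , w~ℓ) = proj₁ (nbrs w w~ℓ) w∈D

  blocking-move : Blocked S D St ℓ → Σ (Fin n) (Unclaimed T S D St) →
                  Σ (Fin n) λ x → Unclaimed T S D St x × ℓ ∈ St ∪ ⁅ x ⁆
  blocking-move {St = St} {ℓ} (ℓ∈S , ℓ∉D , _) (x₀ , x₀-free) with ℓ ∈? St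
  ... | yes ℓ∈St = x₀ , x₀-free , p⊆p∪q ⁅ x₀ ⁆ ℓ∈St
  ... | no  ℓ∉St = ℓ , (ℓ∈S , ℓ∉D , ℓ∉St) , q⊆p∪q St ⁅ ℓ ⁆ (x∈⁅x⁆ ℓ)

  Blocked-move : Blocked S D St ℓ → ℓ ∈ St ∪ ⁅ x ⁆ →
                 (∀ y → y ∈ A → Unclaimed T S D (St ∪ ⁅ x ⁆) y) →
                 Blocked S (D ∪ A) (St ∪ ⁅ x ⁆) ℓ
  Blocked-move {ℓ = ℓ} (ℓ∈S , ℓ∉D , nbrs) ℓ∈St′ A-free =
    ℓ∈S , x∉p∪q ℓ∉D (λ ℓ∈A → proj₂ (proj₂ (A-free ℓ ℓ∈A)) ℓ∈St′) , λ w w~ℓ →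
      let (w∉D , w-taken) = nbrs w w~ℓ
      in x∉p∪q w∉D (w-taken ∘ proj₁ ∘ Unclaimed-staller⁻ ∘ A-free w) ,
         w-taken ∘ proj₁ ∘ Unclaimed-staller⁻ ∘ proj₁ ∘ Unclaimed-dominator⁻

module _ {n : ℕ} (T : Graph n) (b : ℕ) where
  private variable
    ℓ : Fin n
    S S′ D St X Y : Subset n

  Reply : Subset n → ℕ → Subset n → Subset n → Fin n → Set
  Reply S k D St x = Σ (Subset n) λ A →
    (∀ y → y ∈ A → Unclaimed T S D (St ∪ ⁅ x ⁆) y) × ∣ A ∣ ≤ b ×
    DomWins T S b k (D ∪ A) (St ∪ ⁅ x ⁆)

  DomWins-now : ∀ k → Dominates T S D → DomWins T S b k D St
  DomWins-now zero    dom = dom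
  DomWins-now (suc k) dom = inj₁ dom

  simulate : (sim : Simulation T S S′) → ∀ k → Unclaimed T S D St ≐ Unclaimed T S′ X Y →
             Simulation.Related sim D X → DomWins T S′ b k X Y → DomWins T S b k D St
  simulate sim zero    _    related dom        = Simulation.dominates sim related dom
  simulate sim (suc k) _    related (inj₁ dom) = inj₁ (Simulation.dominates sim related dom)
  simulate sim (suc k) same related (inj₂ ((x₀ , x₀-free) , reply)) =
    inj₂ ((x₀ , proj₂ same x₀-free) , λ x x-free →
      let (A , A-free , ∣A∣≤b , won) = reply x (proj₁ same x-free)
      in A , (λ y → proj₂ (≐-staller T same) ∘ A-free y) , ∣A∣≤b ,
         simulate sim k (≐-dominator T (≐-staller T same)) (Simulation.related-∪ sim A related) won)

  Blocked⇒¬DomWins : ∀ m → Blocked T S D St ℓ → ¬ DomWins T S b m D St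
  Blocked⇒¬DomWins zero    blocked dom        = Blocked⇒¬Dominates T blocked dom
  Blocked⇒¬DomWins (suc m) blocked (inj₁ dom) = Blocked⇒¬Dominates T blocked dom
  Blocked⇒¬DomWins (suc m) blocked (inj₂ (x₀-free , reply)) =
    let (x , x-free , ℓ∈St′)   = blocking-move T blocked x₀-free
        (A , A-free , _ , won) = reply x x-free
    in Blocked⇒¬DomWins m (Blocked-move T blocked ℓ∈St′ A-free) won

  IsGammaMB-shift : ∀ t →
    (∀ m → DomWins T S b m ⊥ ⊥ → t ≤ m × DomWins T S′ b (m ∸ t) ⊥ ⊥) →
    (∀ k → DomWins T S′ b k ⊥ ⊥ → DomWins T S b (t + k) ⊥ ⊥) →
    ∀ g → IsGammaMB T S b g ⇔ Σ (Maybe ℕ) λ g′ → IsGammaMB T S′ b g′ × g ≡ t +∞ g′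
  IsGammaMB-shift {S} {S′} t lower upper g = mk⇔ (to g) (from g)
    where
    to : ∀ g → IsGammaMB T S b g → Σ (Maybe ℕ) λ g′ → IsGammaMB T S′ b g′ × g ≡ t +∞ g′
    to nothing never = nothing , (λ k → never (t + k) ∘ upper k) , refl
    to (just m) (won , minimal) =
      just (m ∸ t) , (won′ , minimal′) , cong just (sym (m+[n∸m]≡n t≤m))
      where
      t≤m : t ≤ m
      t≤m = proj₁ (lower m won)
      won′ : DomWins T S′ b (m ∸ t) ⊥ ⊥
      won′ = proj₂ (lower m won)
      minimal′ : ∀ k → k < m ∸ t → ¬ DomWins T S′ b k ⊥ ⊥
      minimal′ k k<m∸t =
        minimal (t + k) (subst (t + k <_) (m+[n∸m]≡n t≤m) (+-monoʳ-< t k<m∸t)) ∘ upper k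

    from : ∀ g → Σ (Maybe ℕ) (λ g′ → IsGammaMB T S′ b g′ × g ≡ t +∞ g′) →
           IsGammaMB T S b g
    from _ (nothing , never′ , refl) k = never′ (k ∸ t) ∘ proj₂ ∘ lower k
    from _ (just m′ , (won′ , minimal′) , refl) = upper m′ won′ , minimal
      where
      minimal : ∀ k → k < t + m′ → ¬ DomWins T S b k ⊥ ⊥
      minimal k k<t+m′ won with lower k won
      ... | t≤k , won′ₖ =
        minimal′ (k ∸ t) (subst (k ∸ t <_) (m+n∸m≡n t m′) (∸-monoˡ-< k<t+m′ t≤k)) won′ₖ

module PendantStars {n : ℕ} (T : Graph n) {b : ℕ} (1≤b : 1 ≤ b) where
  private variable
    k : ℕ
    u v ℓ : Fin n
    S D D′ St A : Subset n
    vs : List (Fin n)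

  pendants : Subset n → Fin n → Subset n
  pendants S v = N T v ∩ leaves T S

  pendant-adjacent : ℓ ∈ pendants S v → Adjacent T v ℓ
  pendant-adjacent {S = S} {v} ℓ∈P = ∈N⁻ T (proj₁ (x∈p∩q⁻ (N T v) (leaves T S) ℓ∈P))

  pendant-leaf : ℓ ∈ pendants S v → ℓ ∈ leaves T S
  pendant-leaf {S = S} {v} ℓ∈P = proj₂ (x∈p∩q⁻ (N T v) (leaves T S) ℓ∈P)

  pendant∈S : ℓ ∈ pendants S v → ℓ ∈ S
  pendant∈S = proj₁ ∘ ∈leaves⁻ T ∘ pendant-leaf

  pendant-unique-neighbour : v ∈ S → ℓ ∈ pendants S v → u ∈ S → Adjacent T u ℓ → u ≡ v
  pendant-unique-neighbour v∈S ℓ∈P u∈S u~ℓ =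
    ∣p∣≡1⇒x≡y (proj₂ (∈leaves⁻ T (pendant-leaf ℓ∈P)))
      (x∈p∩q⁺ (∈N⁺ T (Adjacent-sym T u~ℓ) , u∈S))
      (x∈p∩q⁺ (∈N⁺ T (Adjacent-sym T (pendant-adjacent ℓ∈P)) , v∈S))

  pendants-nonempty : ∣ pendants S v ∣ ≡ b → Nonempty (pendants S v)
  pendants-nonempty ∣P∣≡b = 0<∣p∣⇒Nonempty (subst (0 <_) (sym ∣P∣≡b) 1≤b)

  record PendantStar (S : Subset n) (v : Fin n) : Set where
    field
      centre∈S     : v ∈ S
      ∣pendants∣≡b : ∣ pendants S v ∣ ≡ b

  OutsideIsolated : Subset n → List (Fin n) → Set
  OutsideIsolated S vs = ∀ {x} → x ∉ S → x ∈ˡ vs → ∀ {u} → Adjacent T u x → u ∉ S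

  centre∈forest : OutsideIsolated S (v ∷ vs) → ∣ pendants S v ∣ ≡ b → v ∈ S
  centre∈forest {S} {v} isolated ∣P∣≡b with v ∈? S
  ... | yes v∈S = v∈S
  ... | no  v∉S =
    let (ℓ , ℓ∈P) = pendants-nonempty ∣P∣≡b
    in ⊥-elim (isolated v∉S (hereˡ refl) (Adjacent-sym T (pendant-adjacent ℓ∈P)) (pendant∈S ℓ∈P))

  module Removal {S : Subset n} {v : Fin n} (ps : PendantStar S v) where
    open PendantStar ps

    star : Subset n
    star = ⁅ v ⁆ ∪ pendants S v

    S′ : Subset n
    S′ = stepDown T S v

    centre∈star : v ∈ star
    centre∈star = p⊆p∪q (pendants S v) (x∈⁅x⁆ v)

    pendant∈star : ℓ ∈ pendants S v → ℓ ∈ star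
    pendant∈star = q⊆p∪q ⁅ v ⁆ (pendants S v)

    pendant≢centre : ℓ ∈ pendants S v → ℓ ≢ v
    pendant≢centre ℓ∈P refl = Adjacent-irrefl T (pendant-adjacent ℓ∈P)

    star⊆S : star ⊆ S
    star⊆S = ∪-lub (x∈p⇒⁅x⁆⊆p centre∈S) pendant∈S

    ∣star∣≡1+b : ∣ star ∣ ≡ suc b
    ∣star∣≡1+b = trans (∣p∪q∣≡∣p∣+∣q∣ ⁅ v ⁆ (pendants S v) disjoint)
                       (cong₂ _+_ (∣⁅x⁆∣≡1 v) ∣pendants∣≡b)
      where
      disjoint : Empty (⁅ v ⁆ ∩ pendants S v)
      disjoint (x , x∈) =
        let (x∈⁅v⁆ , x∈P) = x∈p∩q⁻ ⁅ v ⁆ (pendants S v) x∈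
        in pendant≢centre x∈P (x∈⁅y⁆⇒x≡y v x∈⁅v⁆)

    ∣S∣≡∣S′∣+1+b : ∣ S ∣ ≡ ∣ S′ ∣ + suc b
    ∣S∣≡∣S′∣+1+b =
      trans (sym (∣p─q∣+∣q∣≡∣p∣ S star star⊆S)) (cong (∣ S′ ∣ +_) ∣star∣≡1+b)

    ∈S′⁻ : x ∈ S′ → x ∈ S × x ∉ star
    ∈S′⁻ = x∈p─q⁻ S star

    ∈S′⁺ : x ∈ S → x ∉ star → x ∈ S′
    ∈S′⁺ = x∈p∧x∉q⇒x∈p─q

    ∈S⇒∈S′⊎∈star : x ∈ S → x ∈ S′ ⊎ x ∈ star
    ∈S⇒∈S′⊎∈star {x} x∈S with x ∈? star
    ... | yes x∈star = inj₂ x∈star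
    ... | no  x∉star = inj₁ (∈S′⁺ x∈S x∉star)

    ∈star∧∈S′⇒≢ : x ∈ star → y ∈ S′ → x ≢ y
    ∈star∧∈S′⇒≢ x∈star y∈S′ refl = proj₂ (∈S′⁻ y∈S′) x∈star

    pendant-not-adjacent-to-S′ : ℓ ∈ pendants S v → y ∈ S′ → ¬ Adjacent T ℓ y
    pendant-not-adjacent-to-S′ ℓ∈P y∈S′ ℓ~y = ∈star∧∈S′⇒≢ centre∈star y∈S′ (sym
      (pendant-unique-neighbour centre∈S ℓ∈P (proj₁ (∈S′⁻ y∈S′)) (Adjacent-sym T ℓ~y)))

    centre-dominates-star : Dominates T star ⁅ v ⁆
    centre-dominates-star z z∈star =
      [ inj₁ , (λ z∈P → inj₂ (v , x∈⁅x⁆ v , pendant-adjacent z∈P)) ]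
        (x∈p∪q⁻ ⁅ v ⁆ (pendants S v) z∈star)

    star-minus-one-dominates : ∀ x → Dominates T star (star - x)
    star-minus-one-dominates x z z∈star with z ≟ x
    ... | no  z≢x  = inj₁ (x∈p∧x≢y⇒x∈p-y z∈star z≢x)
    ... | yes refl =
      [ centre-case ∘ x∈⁅y⁆⇒x≡y v , pendant-case ] (x∈p∪q⁻ ⁅ v ⁆ (pendants S v) z∈star)
      where
      centre-case : x ≡ v → x ∈ star - x ⊎ Σ (Fin n) λ u → u ∈ star - x × Adjacent T u x
      centre-case x≡v =
        let (ℓ , ℓ∈P) = pendants-nonempty ∣pendants∣≡b
            ℓ≢x : ℓ ≢ x
            ℓ≢x ℓ≡x = pendant≢centre ℓ∈P (trans ℓ≡x x≡v)
        in inj₂ (ℓ , x∈p∧x≢y⇒x∈p-y (pendant∈star ℓ∈P) ℓ≢x ,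
                 subst (Adjacent T ℓ) (sym x≡v) (Adjacent-sym T (pendant-adjacent ℓ∈P)))
      pendant-case : x ∈ pendants S v → x ∈ star - x ⊎ Σ (Fin n) λ u → u ∈ star - x × Adjacent T u x
      pendant-case x∈P =
        inj₂ (v , x∈p∧x≢y⇒x∈p-y centre∈star (pendant≢centre x∈P ∘ sym) , pendant-adjacent x∈P)

    isolated-after-removal : All.All (v ≢_) vs → OutsideIsolated S (v ∷ vs) → OutsideIsolated S′ vs
    isolated-after-removal {vs} v∉vs isolated {x} x∉S′ x∈vs {u} u~x u∈S′ with x ∈? S
    ... | no  x∉S = isolated x∉S (thereˡ x∈vs) u~x (proj₁ (∈S′⁻ u∈S′))
    ... | yes x∈S with ∈S⇒∈S′⊎∈star x∈S
    ...   | inj₁ x∈S′   = x∉S′ x∈S′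
    ...   | inj₂ x∈star with x∈p∪q⁻ ⁅ v ⁆ (pendants S v) x∈star
    ...     | inj₁ x∈⁅v⁆ = All.lookup v∉vs x∈vs (sym (x∈⁅y⁆⇒x≡y v x∈⁅v⁆))
    ...     | inj₂ x∈P   = ∈star∧∈S′⇒≢ centre∈star u∈S′
                             (sym (pendant-unique-neighbour centre∈S x∈P (proj₁ (∈S′⁻ u∈S′)) u~x))

    pendant-blocked : ℓ ∈ pendants S v → ℓ ∉ A →
                      (∀ y → y ∈ A → Unclaimed T S ⊥ (⊥ ∪ ⁅ v ⁆) y) →
                      Blocked T S (⊥ ∪ A) (⊥ ∪ ⁅ v ⁆) ℓ
    pendant-blocked {ℓ} ℓ∈P ℓ∉A A-free =
      pendant∈S ℓ∈P , x∉p∪q ∉⊥ ℓ∉A ,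
      λ w w~ℓ → x∉p∪q ∉⊥ (centre-taken w~ℓ ∘ A-free w) , centre-taken w~ℓ
      where
      centre-taken : ∀ {w D} → Adjacent T w ℓ → ¬ Unclaimed T S D (⊥ ∪ ⁅ v ⁆) w
      centre-taken w~ℓ (w∈S , _ , w∉St) = w∉St (q⊆p∪q ⊥ ⁅ v ⁆
        (subst (_∈ ⁅ v ⁆) (sym (pendant-unique-neighbour centre∈S ℓ∈P w∈S w~ℓ)) (x∈⁅x⁆ v)))

    forget-pendants : Simulation T S′ S
    forget-pendants = record
      { Related   = λ D X → ∀ {u} → u ∈ X → u ∉ pendants S v → u ∈ D
      ; related-∪ = λ {D} {X} A related u∈X∪A u∉P →
          [ p⊆p∪q A ∘ flip related u∉P , q⊆p∪q D A ] (x∈p∪q⁻ X A u∈X∪A)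
      ; dominates = dominates-S′
      }
      where
      dominates-S′ : (∀ {u} → u ∈ D → u ∉ pendants S v → u ∈ D′) →
                     Dominates T S D → Dominates T S′ D′
      dominates-S′ related dom y y∈S′ with dom y (proj₁ (∈S′⁻ y∈S′))
      ... | inj₁ y∈D              = inj₁ (related y∈D (proj₂ (∈S′⁻ y∈S′) ∘ pendant∈star))
      ... | inj₂ (u , u∈D , u~y) =
        inj₂ (u , related u∈D (λ u∈P → pendant-not-adjacent-to-S′ u∈P y∈S′ u~y) , u~y)

    free-after-centre-opening : pendants S v ⊆ A → A ⊆ pendants S v →
                                Unclaimed T S′ ⊥ ⊥ ≐ Unclaimed T S (⊥ ∪ A) (⊥ ∪ ⁅ v ⁆)
    free-after-centre-opening {A} P⊆A A⊆P = to , from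
      where
      to : ∀ {z} → Unclaimed T S′ ⊥ ⊥ z → Unclaimed T S (⊥ ∪ A) (⊥ ∪ ⁅ v ⁆) z
      to (z∈S′ , _ , _) =
        let (z∈S , z∉star) = ∈S′⁻ z∈S′
        in z∈S , x∉p∪q ∉⊥ (z∉star ∘ pendant∈star ∘ A⊆P) ,
           x∉p∪q ∉⊥ (z∉star ∘ p⊆p∪q (pendants S v))
      from : ∀ {z} → Unclaimed T S (⊥ ∪ A) (⊥ ∪ ⁅ v ⁆) z → Unclaimed T S′ ⊥ ⊥ z
      from (z∈S , z∉A , z∉v) =
        ∈S′⁺ z∈S (x∉p∪q (proj₂ (x∉p∪q⁻ ⊥ z∉v)) (proj₂ (x∉p∪q⁻ ⊥ z∉A) ∘ P⊆A)) , ∉⊥ , ∉⊥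

    peel-lower : ∀ m → DomWins T S b m ⊥ ⊥ → Σ ℕ λ m′ → m ≡ suc m′ × DomWins T S′ b m′ ⊥ ⊥
    peel-lower zero    dom        = ⊥-elim (¬Dominates-⊥ T centre∈S dom)
    peel-lower (suc m) (inj₁ dom) = ⊥-elim (¬Dominates-⊥ T centre∈S dom)
    peel-lower (suc m) (inj₂ (_ , reply)) with reply v (centre∈S , ∉⊥ , ∉⊥)
    ... | A , A-free , ∣A∣≤b , won with any? (λ ℓ → ℓ ∈? pendants S v ×-dec ¬? (ℓ ∈? A))
    ...   | yes (ℓ , ℓ∈P , ℓ∉A) =
      ⊥-elim (Blocked⇒¬DomWins T b m (pendant-blocked ℓ∈P ℓ∉A A-free) won)
    ...   | no  none-missed =
      m , refl , simulate T b forget-pendants m (free-after-centre-opening P⊆A A⊆P) claimed⊆P won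
      where
      P⊆A : pendants S v ⊆ A
      P⊆A {ℓ} ℓ∈P with ℓ ∈? A
      ... | yes ℓ∈A = ℓ∈A
      ... | no  ℓ∉A = contradiction (ℓ , ℓ∈P , ℓ∉A) none-missed
      A⊆P : A ⊆ pendants S v
      A⊆P = p⊆q∧∣q∣≤∣p∣⇒q⊆p P⊆A (≤-trans ∣A∣≤b (≤-reflexive (sym ∣pendants∣≡b)))
      claimed⊆P : ∀ {u} → u ∈ ⊥ ∪ A → u ∉ pendants S v → u ∈ ⊥
      claimed⊆P u∈⊥∪A u∉P = [ id , ⊥-elim ∘ u∉P ∘ A⊆P ] (x∈p∪q⁻ ⊥ A u∈⊥∪A)

    star-free : D ⊆ S′ → St ⊆ S′ → x ∈ star → Unclaimed T S D St x
    star-free D⊆S′ St⊆S′ x∈star =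
      star⊆S x∈star ,
      (λ x∈D → proj₂ (∈S′⁻ (D⊆S′ x∈D)) x∈star) ,
      (λ x∈St → proj₂ (∈S′⁻ (St⊆S′ x∈St)) x∈star)

    complete-star : Simulation T S S′
    complete-star = record
      { Related   = λ D X → X ⊆ D × Dominates T star D
      ; related-∪ = λ {D} A (X⊆D , dom) →
          ∪-lub (p⊆p∪q A ∘ X⊆D) (q⊆p∪q D A) , Dominates-mono T (p⊆p∪q A) dom
      ; dominates = λ (X⊆D , dom-star) dom-S′ →
          Dominates-cover T ∈S⇒∈S′⊎∈star (Dominates-mono T X⊆D dom-S′) dom-star
      }

    free-after-star-reply : x ∈ star →
      Unclaimed T S (D ∪ (star - x)) (St ∪ ⁅ x ⁆) ≐ Unclaimed T S′ D St
    free-after-star-reply {x} {D} {St} x∈star = to , from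
      where
      to : ∀ {z} → Unclaimed T S (D ∪ (star - x)) (St ∪ ⁅ x ⁆) z → Unclaimed T S′ D St z
      to {z} (z∈S , z∉D∪ , z∉St∪) =
        let (z∉D , z∉star-x) = x∉p∪q⁻ D z∉D∪
            (z∉St , z∉⁅x⁆)   = x∉p∪q⁻ St z∉St∪
            z∉star : z ∉ star
            z∉star z∈star = z∉star-x (x∈p∧x≢y⇒x∈p-y z∈star (x∉⁅y⁆⇒x≢y z∉⁅x⁆))
        in ∈S′⁺ z∈S z∉star , z∉D , z∉St
      from : ∀ {z} → Unclaimed T S′ D St z → Unclaimed T S (D ∪ (star - x)) (St ∪ ⁅ x ⁆) z
      from (z∈S′ , z∉D , z∉St) =
        let (z∈S , z∉star) = ∈S′⁻ z∈S′
        in z∈S , x∉p∪q z∉D (z∉star ∘ proj₁ ∘ x∈p─q⁻ star ⁅ x ⁆) ,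
           x∉p∪q z∉St (x≢y⇒x∉⁅y⁆ (∈star∧∈S′⇒≢ x∈star z∈S′ ∘ sym))

    claim-rest-of-star : D ⊆ S′ → St ⊆ S′ → x ∈ star →
                         DomWins T S′ b k D St → Reply T b S k D St x
    claim-rest-of-star {D} {St} {x} {k} D⊆S′ St⊆S′ x∈star won =
      star - x , rest-free , ∣star-x∣≤b ,
      simulate T b complete-star k (free-after-star-reply x∈star)
        (p⊆p∪q (star - x) , Dominates-mono T (q⊆p∪q D (star - x)) (star-minus-one-dominates x)) won
      where
      rest-free : ∀ y → y ∈ star - x → Unclaimed T S D (St ∪ ⁅ x ⁆) y
      rest-free y y∈ =
        let (y∈star , y∉⁅x⁆) = x∈p─q⁻ star ⁅ x ⁆ y∈
        in Unclaimed-staller⁺ T (star-free D⊆S′ St⊆S′ y∈star) (x∉⁅y⁆⇒x≢y y∉⁅x⁆)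
      ∣star-x∣≤b : ∣ star - x ∣ ≤ b
      ∣star-x∣≤b = ≤-pred (subst (∣ star - x ∣ <_) ∣star∣≡1+b (x∈p⇒∣p-x∣<∣p∣ x∈star))

    claim-centre : D ⊆ S′ → St ⊆ S′ → x ∈ S′ → Dominates T S′ D → Reply T b S k D St x
    claim-centre {D} {St} {x} {k} D⊆S′ St⊆S′ x∈S′ dom =
      ⁅ v ⁆ , centre-free , subst (_≤ b) (sym (∣⁅x⁆∣≡1 v)) 1≤b ,
      DomWins-now T b k (Dominates-cover T ∈S⇒∈S′⊎∈star
        (Dominates-mono T (p⊆p∪q ⁅ v ⁆) dom)
        (Dominates-mono T (q⊆p∪q D ⁅ v ⁆) centre-dominates-star))
      where
      centre-free : ∀ y → y ∈ ⁅ v ⁆ → Unclaimed T S D (St ∪ ⁅ x ⁆) y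
      centre-free y y∈⁅v⁆ =
        let y∈star = p⊆p∪q (pendants S v) y∈⁅v⁆
        in Unclaimed-staller⁺ T (star-free D⊆S′ St⊆S′ y∈star) (∈star∧∈S′⇒≢ y∈star x∈S′)

    untouched-star : ∀ k → D ⊆ S′ → St ⊆ S′ →
                     DomWins T S′ b k D St → DomWins T S b (suc k) D St
    reply-in-S′    : ∀ k → D ⊆ S′ → St ⊆ S′ → Unclaimed T S′ D St x →
                     DomWins T S′ b k D St → Reply T b S k D St x

    untouched-star {D} {St} k D⊆S′ St⊆S′ won =
      inj₂ ((v , star-free D⊆S′ St⊆S′ centre∈star) , reply)
      where
      reply : ∀ x → Unclaimed T S D St x → Reply T b S k D St x
      reply x (x∈S , x∉D , x∉St) with ∈S⇒∈S′⊎∈star x∈S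
      ... | inj₁ x∈S′   = reply-in-S′ k D⊆S′ St⊆S′ (x∈S′ , x∉D , x∉St) won
      ... | inj₂ x∈star = claim-rest-of-star D⊆S′ St⊆S′ x∈star won

    reply-in-S′ zero    D⊆S′ St⊆S′ (x∈S′ , _) dom        = claim-centre D⊆S′ St⊆S′ x∈S′ dom
    reply-in-S′ (suc k) D⊆S′ St⊆S′ (x∈S′ , _) (inj₁ dom) = claim-centre D⊆S′ St⊆S′ x∈S′ dom
    reply-in-S′ {x = x} (suc k) D⊆S′ St⊆S′ x-free (inj₂ (_ , reply)) =
      let (A , A-free , ∣A∣≤b , won) = reply x x-free
      in A , (λ y → map₁ (proj₁ ∘ ∈S′⁻) ∘ A-free y) , ∣A∣≤b ,
         untouched-star k (∪-lub D⊆S′ (λ {y} → proj₁ ∘ A-free y))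
                          (∪-lub St⊆S′ (x∈p⇒⁅x⁆⊆p (proj₁ x-free))) won

    peel-upper : ∀ k → DomWins T S′ b k ⊥ ⊥ → DomWins T S b (suc k) ⊥ ⊥
    peel-upper k = untouched-star k ⊥⊆ ⊥⊆

  data Peeling : Subset n → List (Fin n) → Set where
    []  : Peeling S []
    _∷_ : PendantStar S v → Peeling (stepDown T S v) vs → Peeling S (v ∷ vs)

  admissible⇒Peeling : OutsideIsolated S vs → Unique vs → AdmissibleFrom T b S vs → Peeling S vs
  admissible⇒Peeling {vs = []}     _        _               _                    = []
  admissible⇒Peeling {S} {v ∷ vs} isolated (v∉vs ∷ unique) (∣P∣≡b , admissible) =
    ps ∷ admissible⇒Peeling (Removal.isolated-after-removal ps v∉vs isolated) unique admissible
    where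
    ps : PendantStar S v
    ps = record { centre∈S = centre∈forest isolated ∣P∣≡b ; ∣pendants∣≡b = ∣P∣≡b }

  Peeling-size : Peeling S vs → ∣ S ∣ ≡ ∣ down T S vs ∣ + length vs * suc b
  Peeling-size []                          = sym (+-identityʳ _)
  Peeling-size {S} {v ∷ vs} (ps ∷ peeling) = begin
    ∣ S ∣                                ≡⟨ ∣S∣≡∣S′∣+1+b ⟩
    ∣ S′ ∣ + suc b                       ≡⟨ cong (_+ suc b) (Peeling-size peeling) ⟩
    ∣ F ∣ + length vs * suc b + suc b   ≡⟨ +-assoc ∣ F ∣ (length vs * suc b) (suc b) ⟩
    ∣ F ∣ + (length vs * suc b + suc b) ≡⟨ cong (∣ F ∣ +_) (+-comm (length vs * suc b) (suc b)) ⟩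
    ∣ F ∣ + (suc b + length vs * suc b) ∎
    where
    open Removal ps
    F : Subset n
    F = down T S′ vs

  Peeling-lower : Peeling S vs → ∀ m → DomWins T S b m ⊥ ⊥ →
                  length vs ≤ m × DomWins T (down T S vs) b (m ∸ length vs) ⊥ ⊥
  Peeling-lower []             m won = z≤n , won
  Peeling-lower (ps ∷ peeling) m won with Removal.peel-lower ps m won
  ... | m′ , refl , won′ = map s≤s id (Peeling-lower peeling m′ won′)

  Peeling-upper : Peeling S vs → ∀ k → DomWins T (down T S vs) b k ⊥ ⊥ →
                  DomWins T S b (length vs + k) ⊥ ⊥
  Peeling-upper []             k won = won
  Peeling-upper (ps ∷ peeling) k won = Removal.peel-upper ps _ (Peeling-upper peeling k won)

  Peeling-rounds : Peeling ⊤ vs → (n ∸ ∣ T↓ T vs ∣) / suc b ≡ length vs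
  Peeling-rounds {vs} peeling = begin
    (n ∸ ∣ F ∣) / suc b                          ≡⟨ cong (λ m → (m ∸ ∣ F ∣) / suc b) n≡∣F∣+t[1+b] ⟩
    (∣ F ∣ + length vs * suc b ∸ ∣ F ∣) / suc b ≡⟨ cong (_/ suc b) (m+n∸m≡n ∣ F ∣ _) ⟩
    length vs * suc b / suc b                    ≡⟨ m*n/n≡m (length vs) (suc b) ⟩
    length vs                                    ∎
    where
    F : Subset n
    F = T↓ T vs
    n≡∣F∣+t[1+b] : n ≡ ∣ F ∣ + length vs * suc b
    n≡∣F∣+t[1+b] = trans (sym (∣⊤∣≡n n)) (Peeling-size peeling)

open PendantStars using (admissible⇒Peeling; Peeling-rounds; Peeling-lower; Peeling-upper)

lemma4p6 : (n b : ℕ) → 1 ≤ b → (T : Graph n) → IsTree T → Good T b →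
    (vs : List (Fin n)) → Admissible T b vs →
    (g : Maybe ℕ) →
    IsGammaMB T ⊤ b g ⇔
      Σ (Maybe ℕ) (λ g′ → IsGammaMB T (T↓ T vs) b g′ ×
        g ≡ ((n ∸ ∣ T↓ T vs ∣) / suc b) +∞ g′)
lemma4p6 n b 1≤b T _ _ vs (unique , admissible) g
  with peeling ← admissible⇒Peeling T 1≤b (λ x∉⊤ → contradiction ∈⊤ x∉⊤) unique admissible
  rewrite Peeling-rounds T 1≤b peeling =
  IsGammaMB-shift T b (length vs) (Peeling-lower T 1≤b peeling) (Peeling-upper T 1≤b peeling) g
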